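{- Let $p,t$ be positive integers with $p$ prime. If there exists a rainbow-free $r$-coloring of $\mathbb{Z}_t$ with respect to Schur triples, then there exists a rainbow-free $(r+rb(\mathbb{Z}_p,1)-2)$-coloring of $\mathbb{Z}_{pt}$ with respect to Schur triples.
   Context: An $r$-coloring of $\mathbb{Z}_n$ is a surjective map $c:\mathbb{Z}_n\to\{1,\dots,r\}$. A Schur triple is $(x_1,x_2,x_3)\in\mathbb{Z}_n^3$ with $x_1+x_2\equiv x_3\pmod n$; it is rainbow under $c$ if $c(x_1),c(x_2),c(x_3)$ are pairwise distinct, and $c$ is rainbow-free if no Schur triple is rainbow. $rb(\mathbb{Z}_n,1)$ is the smallest positive integer $r$ such that every $r$-coloring of $\mathbb{Z}_n$ admits a rainbow Schur triple (by convention $n+1$ if no such $r$ exists). -}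

module Defs where

open import Data.Nat using (ℕ; _+_; _*_; _≤_; _<_)
open import Data.Fin using (Fin; toℕ)
open import Data.Product using (Σ; ∃; _×_)
open import Relation.Binary.PropositionalEquality using (_≡_; _≢_)
open import Relation.Nullary using (¬_)

-- Z_n is represented by Fin n (residues 0..n-1); colors {1..r} by Fin r.

SchurTriple : (n : ℕ) → Fin n → Fin n → Fin n → Set
SchurTriple n x₁ x₂ x₃ = ∃ λ k → toℕ x₁ + toℕ x₂ ≡ toℕ x₃ + k * n

IsColoring : (n r : ℕ) → (Fin n → Fin r) → Set
IsColoring n r c = ∀ (j : Fin r) → ∃ λ (x : Fin n) → c x ≡ j

Rainbow : {n r : ℕ} → (Fin n → Fin r) → Fin n → Fin n → Fin n → Set
Rainbow c x₁ x₂ x₃ = (c x₁ ≢ c x₂) × (c x₁ ≢ c x₃) × (c x₂ ≢ c x₃)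

HasRainbowSchur : (n r : ℕ) → (Fin n → Fin r) → Set
HasRainbowSchur n r c =
  ∃ λ x₁ → ∃ λ x₂ → ∃ λ x₃ → SchurTriple n x₁ x₂ x₃ × Rainbow c x₁ x₂ x₃

RainbowFree : (n r : ℕ) → (Fin n → Fin r) → Set
RainbowFree n r c = ¬ HasRainbowSchur n r c

ExistsRainbowFreeColoring : (n r : ℕ) → Set
ExistsRainbowFreeColoring n r =
  ∃ λ (c : Fin n → Fin r) → IsColoring n r c × RainbowFree n r c

Forces : (n r : ℕ) → Set
Forces n r = ∀ (c : Fin n → Fin r) → IsColoring n r c → HasRainbowSchur n r c

-- rb(Z_n,1) = k : k is the smallest positive integer r with Forces n r.
-- (For r > n there is no surjective coloring, so Forces n (n+1) holds vacuously;
--  hence the paper's convention "n+1 if no such r exists" is automatically covered.)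
IsRb : (n k : ℕ) → Set
IsRb n k = (1 ≤ k) × Forces n k × (∀ r → 1 ≤ r → r < k → ¬ Forces n r)

module Submission where

-- Let c₁ be a rainbow-free r-colouring of Z_t and let k = rb(Z_p,1).  Since
-- colourings with at most two colours are never rainbow, k ≥ 3; by minimality
-- of k and because everything is finite (hence decidable), there is a
-- rainbow-free (k-1)-colouring c₂ of Z_p.  Colour n ∈ Z_{pt} by c₁(n/p) when
-- p ∣ n, and otherwise by c₂(n mod p), after merging the colour R = c₂(0) with
-- one other colour; this uses r + (k - 2) colours.  A Schur triple with all
-- terms divisible by p is a Schur triple of Z_t, one with no term divisible by
-- p is a Schur triple of Z_p, and exactly two divisible terms is impossible.
-- If exactly one of x₁, x₂ is divisible, the other two terms are congruent
-- mod p.  The remaining case x₁ + x₂ ≡ 0 (mod p) is the heart of the proof: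
-- a translation argument (the multiples of a unit v exhaust Z_p) shows that if
-- c₂(x₁) = R ≠ c₂(x₂) then only R and c₂(x₂) can occur, so c₂(x₂) must be the
-- colour merged with R.

open import Defs
open import Data.Nat using (ℕ; zero; suc; _+_; _*_; _∸_; _≤_; _<_; z≤n; s≤s; NonZero; >-nonZero; nonTrivial⇒n>1) renaming (_≟_ to _≟ℕ_)
open import Data.Nat.Properties using (_≤?_; ≤-trans; ≰⇒>; n<1+n; +-assoc; +-comm; +-identityʳ; *-assoc; *-comm; *-distribʳ-+; *-cancelʳ-≡; *-monoˡ-<; <-≤-trans; m≤m*n; +-∸-assoc)
open import Data.Nat.DivMod using (_%_; _/_; _mod_; m%n<n; m≡m%n+[m/n]*n; [m+kn]%n≡m%n; m*n%n≡0; m<n⇒m%n≡m; %-distribˡ-+; %-remove-+ˡ; %-remove-+ʳ)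
open import Data.Nat.Divisibility using (_∣_; divides; divides-refl; _∣?_; ∣-trans; n∣m*n; m∣m*n; ∣m∣n⇒∣m+n; m%n≡0⇒n∣m; n∣m⇒m%n≡0)
open import Data.Nat.Primality using (Prime; prime⇒irreducible; prime⇒nonZero; prime⇒nonTrivial)
open import Data.Nat.Coprimality using (Coprime; coprime-Bézout)
open import Data.Nat.GCD using (module Bézout)
open import Data.Nat.Tactic.RingSolver using (solve-∀)
open import Data.Fin using (Fin; zero; suc; toℕ; fromℕ<; inject≤; _↑ˡ_; _↑ʳ_; splitAt; punchIn; punchOut; finToFun; funToFin)
open import Data.Fin.Properties using (_≟_; any?; all?; toℕ<n; toℕ-fromℕ<; toℕ-inject≤; toℕ-injective; finToFun-funToFin; punchInᵢ≢i; punchOut-cong; punchOut-punchIn; splitAt⁻¹-↑ˡ; splitAt⁻¹-↑ʳ)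
open import Data.Product using (∃; _×_; _,_; proj₁; proj₂)
open import Data.Sum using (_⊎_; inj₁; inj₂)
open import Data.Empty using (⊥-elim)
open import Function using (_∘_)
open import Relation.Nullary using (¬_; Dec; yes; no)
open import Relation.Nullary.Decidable using (¬?; _×-dec_; map′)
open import Relation.Binary.Definitions using (DecidableEquality)
open import Relation.Binary.PropositionalEquality using (_≡_; _≢_; _≗_; refl; sym; trans; cong; cong₂; subst; module ≡-Reasoning)

open _∣_ using (quotient)

Distinct3 : {A : Set} → A → A → A → Set
Distinct3 a b d = (a ≢ b) × (a ≢ d) × (b ≢ d)

distinct-reflect : {A B : Set} (f : A → B) {a b d : A} →
  Distinct3 (f a) (f b) (f d) → Distinct3 a b d
distinct-reflect f (fa≢fb , fa≢fd , fb≢fd) = fa≢fb ∘ cong f , fa≢fd ∘ cong f , fb≢fd ∘ cong f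

not-distinct : {A : Set} → DecidableEquality A → {a b d : A} →
  ¬ Distinct3 a b d → a ≢ b → a ≡ d ⊎ b ≡ d
not-distinct _≟A_ {a} {b} {d} ¬abd a≢b with a ≟A d | b ≟A d
... | yes a≡d | _       = inj₁ a≡d
... | no _    | yes b≡d = inj₂ b≡d
... | no a≢d  | no b≢d  = ⊥-elim (¬abd (a≢b , a≢d , b≢d))

fewColours-notDistinct : ∀ {r} → r ≤ 2 → (a b d : Fin r) → ¬ Distinct3 a b d
fewColours-notDistinct (s≤s z≤n)       zero       zero       _          (a≢b , _) = a≢b refl
fewColours-notDistinct (s≤s (s≤s z≤n)) zero       zero       _          (a≢b , _) = a≢b refl
fewColours-notDistinct (s≤s (s≤s z≤n)) (suc zero) (suc zero) _          (a≢b , _) = a≢b refl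
fewColours-notDistinct (s≤s (s≤s z≤n)) zero       (suc zero) zero       (_ , a≢d , _) = a≢d refl
fewColours-notDistinct (s≤s (s≤s z≤n)) (suc zero) zero       (suc zero) (_ , a≢d , _) = a≢d refl
fewColours-notDistinct (s≤s (s≤s z≤n)) zero       (suc zero) (suc zero) (_ , _ , b≢d) = b≢d refl
fewColours-notDistinct (s≤s (s≤s z≤n)) (suc zero) zero       zero       (_ , _ , b≢d) = b≢d refl

schur⇒mod : ∀ {n} .{{_ : NonZero n}} (a b c : Fin n) →
  SchurTriple n a b c → (toℕ a + toℕ b) % n ≡ toℕ c
schur⇒mod {n} a b c (k , eq) =
  trans (cong (_% n) eq) (trans ([m+kn]%n≡m%n (toℕ c) k n) (m<n⇒m%n≡m (toℕ<n c)))

mod⇒schur : ∀ {n} .{{_ : NonZero n}} (a b c : Fin n) →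
  (toℕ a + toℕ b) % n ≡ toℕ c → SchurTriple n a b c
mod⇒schur {n} a b c eq =
  (toℕ a + toℕ b) / n , trans (m≡m%n+[m/n]*n (toℕ a + toℕ b) n) (cong (_+ (toℕ a + toℕ b) / n * n) eq)

schur? : ∀ {n} (a b c : Fin n) → Dec (SchurTriple n a b c)
schur? {suc n} a b c = map′ (mod⇒schur a b c) (schur⇒mod a b c) ((toℕ a + toℕ b) % suc n ≟ℕ toℕ c)

hasRainbowSchur? : ∀ {n r} (c : Fin n → Fin r) → Dec (HasRainbowSchur n r c)
hasRainbowSchur? c = any? λ x → any? λ y → any? λ z →
  schur? x y z ×-dec (¬? (c x ≟ c y) ×-dec ¬? (c x ≟ c z) ×-dec ¬? (c y ≟ c z))

isColoring? : ∀ {n r} (c : Fin n → Fin r) → Dec (IsColoring n r c)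
isColoring? c = all? λ j → any? λ x → c x ≟ j

Extensional : ∀ {n m} → ((Fin n → Fin m) → Set) → Set
Extensional P = ∀ {f g} → f ≗ g → P f → P g

-- Existence of a function Fin n → Fin m with a decidable extensional
-- property is decidable: search through the codes Fin (m ^ n) of all functions.
∃-function? : ∀ {n m} {P : (Fin n → Fin m) → Set} →
  Extensional P → (∀ f → Dec (P f)) → Dec (∃ P)
∃-function? ext P? with any? (λ i → P? (finToFun i))
... | yes (i , Pi) = yes (finToFun i , Pi)
... | no ¬∃i = no λ (f , Pf) → ¬∃i (funToFin f , ext (sym ∘ finToFun-funToFin f) Pf)

rainbowFreeColoring-ext : ∀ {n r} → Extensional (λ c → IsColoring n r c × RainbowFree n r c)
rainbowFreeColoring-ext f≗g (onto , free) =
  (λ j → proj₁ (onto j) , trans (sym (f≗g (proj₁ (onto j)))) (proj₂ (onto j))) ,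
  λ (x , y , z , s , (gx≢gy , gx≢gz , gy≢gz)) → free (x , y , z , s ,
    (λ e → gx≢gy (trans (sym (f≗g x)) (trans e (f≗g y)))) ,
    (λ e → gx≢gz (trans (sym (f≗g x)) (trans e (f≗g z)))) ,
    (λ e → gy≢gz (trans (sym (f≗g y)) (trans e (f≗g z)))))

-- Classically immediate, constructively by finiteness: if r colours do not
-- force a rainbow triple, some rainbow-free r-colouring exists.
¬forces⇒rainbowFree : ∀ {n r} → ¬ Forces n r → ExistsRainbowFreeColoring n r
¬forces⇒rainbowFree {n} {r} ¬forces
  with ∃-function? rainbowFreeColoring-ext (λ c → isColoring? c ×-dec ¬? (hasRainbowSchur? c))
... | yes witness = witness
... | no ¬witness = ⊥-elim (¬forces forces)
  where
  forces : Forces n r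
  forces c onto with hasRainbowSchur? c
  ... | yes rainbow = rainbow
  ... | no free = ⊥-elim (¬witness (c , onto , free))

toℕ-mod : ∀ a n .{{_ : NonZero n}} → toℕ (a mod n) ≡ a % n
toℕ-mod a n = toℕ-fromℕ< (m%n<n a n)

mod-isColoring : ∀ {n r} .{{_ : NonZero r}} → r ≤ n → IsColoring n r (λ x → toℕ x mod r)
mod-isColoring {r = r} r≤n j = inject≤ j r≤n , toℕ-injective (begin
  toℕ (toℕ (inject≤ j r≤n) mod r) ≡⟨ toℕ-mod _ r ⟩
  toℕ (inject≤ j r≤n) % r         ≡⟨ cong (_% r) (toℕ-inject≤ j r≤n) ⟩
  toℕ j % r                       ≡⟨ m<n⇒m%n≡m (toℕ<n j) ⟩
  toℕ j                           ∎)
  where open ≡-Reasoning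

fewColours-¬forces : ∀ {n r} → 1 ≤ r → r ≤ 2 → r ≤ n → ¬ Forces n r
fewColours-¬forces {r = r} 1≤r r≤2 r≤n forces
  with forces _ (mod-isColoring {{>-nonZero 1≤r}} r≤n)
... | _ , _ , _ , _ , rainbow = fewColours-notDistinct r≤2 _ _ _ rainbow

rb≥3 : ∀ {n k} → 2 ≤ n → IsRb n k → 3 ≤ k
rb≥3 {k = k} 2≤n (1≤k , forces , _) with k ≤? 2
... | yes k≤2 = ⊥-elim (fewColours-¬forces 1≤k k≤2 (≤-trans k≤2 2≤n) forces)
... | no k≰2 = ≰⇒> k≰2

onℕ : ∀ {n r} .{{_ : NonZero n}} → (Fin n → Fin r) → ℕ → Fin r
onℕ {n} c a = c (a mod n)

onℕ-cong : ∀ {n r} .{{_ : NonZero n}} (c : Fin n → Fin r) {a b : ℕ} →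
  a % n ≡ b % n → onℕ c a ≡ onℕ c b
onℕ-cong {n} c {a} {b} eq =
  cong c (toℕ-injective (trans (toℕ-mod a n) (trans eq (sym (toℕ-mod b n)))))

onℕ-toℕ : ∀ {n r} .{{_ : NonZero n}} (c : Fin n → Fin r) (x : Fin n) → onℕ c (toℕ x) ≡ c x
onℕ-toℕ {n} c x = cong c (toℕ-injective (trans (toℕ-mod (toℕ x) n) (m<n⇒m%n≡m (toℕ<n x))))

onℕ-rainbowFree : ∀ {n r} .{{_ : NonZero n}} {c : Fin n → Fin r} → RainbowFree n r c →
  ∀ {a b d} → (a + b) % n ≡ d % n → ¬ Distinct3 (onℕ c a) (onℕ c b) (onℕ c d)
onℕ-rainbowFree {n} free {a} {b} {d} eq rainbow =
  free (a mod n , b mod n , d mod n , mod⇒schur (a mod n) (b mod n) (d mod n) (begin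
    (toℕ (a mod n) + toℕ (b mod n)) % n ≡⟨ cong₂ (λ x y → (x + y) % n) (toℕ-mod a n) (toℕ-mod b n) ⟩
    (a % n + b % n) % n                 ≡⟨ sym (%-distribˡ-+ a b n) ⟩
    (a + b) % n                         ≡⟨ eq ⟩
    d % n                               ≡⟨ sym (toℕ-mod d n) ⟩
    toℕ (d mod n)                       ∎) , rainbow)
  where open ≡-Reasoning

module SchurCongruence {p : ℕ} .{{_ : NonZero p}} (n₁ n₂ n₃ : ℕ) (schur : (n₁ + n₂) % p ≡ n₃ % p) where

  ∣-first⇒congruent : p ∣ n₁ → n₂ % p ≡ n₃ % p
  ∣-first⇒congruent p∣n₁ = trans (sym (%-remove-+ˡ n₂ p∣n₁)) schur

  ∣-second⇒congruent : p ∣ n₂ → n₁ % p ≡ n₃ % p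
  ∣-second⇒congruent p∣n₂ = trans (sym (%-remove-+ʳ n₁ p∣n₂)) schur

  ∣-summands : p ∣ n₁ → p ∣ n₂ → p ∣ n₃
  ∣-summands p∣n₁ p∣n₂ = m%n≡0⇒n∣m n₃ p (trans (sym schur) (n∣m⇒m%n≡0 _ p (∣m∣n⇒∣m+n p∣n₁ p∣n₂)))

  ∣-first-sum : p ∣ n₁ → p ∣ n₃ → p ∣ n₂
  ∣-first-sum p∣n₁ p∣n₃ = m%n≡0⇒n∣m n₂ p (trans (∣-first⇒congruent p∣n₁) (n∣m⇒m%n≡0 n₃ p p∣n₃))

  ∣-second-sum : p ∣ n₂ → p ∣ n₃ → p ∣ n₁
  ∣-second-sum p∣n₂ p∣n₃ = m%n≡0⇒n∣m n₁ p (trans (∣-second⇒congruent p∣n₂) (n∣m⇒m%n≡0 n₃ p p∣n₃))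

  ∣-sum⇒∣-summands-sum : p ∣ n₃ → p ∣ n₁ + n₂
  ∣-sum⇒∣-summands-sum p∣n₃ = m%n≡0⇒n∣m (n₁ + n₂) p (trans schur (n∣m⇒m%n≡0 n₃ p p∣n₃))

-- A v coprime to p generates Z_p: every b can be moved to 0 by adding
-- multiples of v.  From Bézout, 1 + y v = x p gives n = b y, and
-- 1 + x p = y v gives n = b (p - 1) y.
coprime⇒reaches-multiple : ∀ {p v} .{{_ : NonZero p}} → Coprime p v →
  ∀ b → ∃ λ n → p ∣ b + n * v
coprime⇒reaches-multiple {suc q} {v} p⊥v b with coprime-Bézout p⊥v
... | Bézout.+- x y 1+yv≡xp = b * y , divides (b * x) (begin
  b + b * y * v   ≡⟨ factor b y v ⟩
  b * (1 + y * v) ≡⟨ cong (b *_) 1+yv≡xp ⟩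
  b * (x * suc q) ≡⟨ sym (*-assoc b x (suc q)) ⟩
  b * x * suc q   ∎)
  where
  open ≡-Reasoning
  factor : ∀ b y v → b + b * y * v ≡ b * (1 + y * v)
  factor = solve-∀
... | Bézout.-+ x y 1+xp≡yv = b * q * y , divides (b + b * q * x) (begin
  b + b * q * y * v           ≡⟨ cong (b +_) (*-assoc (b * q) y v) ⟩
  b + b * q * (y * v)         ≡⟨ cong (λ z → b + b * q * z) (sym 1+xp≡yv) ⟩
  b + b * q * (1 + x * suc q) ≡⟨ factor b q x ⟩
  (b + b * q * x) * suc q     ∎)
  where
  open ≡-Reasoning
  factor : ∀ b q x → b + b * q * (1 + x * suc q) ≡ (b + b * q * x) * suc q
  factor = solve-∀

prime∤⇒coprime : ∀ {p v} → Prime p → ¬ p ∣ v → Coprime p v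
prime∤⇒coprime p-prime p∤v (d∣p , d∣v) with prime⇒irreducible p-prime d∣p
... | inj₁ d≡1 = d≡1
... | inj₂ refl = ⊥-elim (p∤v d∣v)

module ModPrime {p m} .{{_ : NonZero p}} (p-prime : Prime p)
  (c : Fin p → Fin m) (free : RainbowFree p m c) where

  C : ℕ → Fin m
  C = onℕ c

  R : Fin m
  R = C 0

  multiple-R : ∀ {a} → p ∣ a → C a ≡ R
  multiple-R p∣a = onℕ-cong c (trans (n∣m⇒m%n≡0 _ p p∣a) (sym (m*n%n≡0 0 p)))

  sum-colour : ∀ a b → C a ≢ C b → C a ≡ C (a + b) ⊎ C b ≡ C (a + b)
  sum-colour a b = not-distinct _≟_ (onℕ-rainbowFree free refl)

  returns : ∀ {u v} → p ∣ u + v → ∀ w → C (w + v + u) ≡ C w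
  returns {u} {v} p∣u+v w = onℕ-cong c (begin
    (w + v + u) % p   ≡⟨ cong (_% p) (trans (+-assoc w v u) (cong (w +_) (+-comm v u))) ⟩
    (w + (u + v)) % p ≡⟨ %-remove-+ʳ w p∣u+v ⟩
    w % p             ∎)
    where open ≡-Reasoning

  module _ {u v b : ℕ} (p∣u+v : p ∣ u + v) (Cu≡R : C u ≡ R) (Cv≢R : C v ≢ R)
    (Cb≢R : C b ≢ R) (Cb≢Cv : C b ≢ C v) where

    -- If C (w + v) were C v, the triple (w + v, u, w + v + u) would be rainbow.
    translate : ∀ w → C w ≡ C b → C (w + v) ≡ C b
    translate w Cw≡Cb with sum-colour w v (Cb≢Cv ∘ trans (sym Cw≡Cb))
    ... | inj₁ Cw≡Cw+v = trans (sym Cw≡Cw+v) Cw≡Cb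
    ... | inj₂ Cv≡Cw+v with sum-colour (w + v) u (λ e → Cv≢R (trans Cv≡Cw+v (trans e Cu≡R)))
    ...   | inj₁ Cw+v≡Cw = ⊥-elim (Cb≢Cv (sym (trans Cv≡Cw+v (trans Cw+v≡Cw (trans (returns p∣u+v w) Cw≡Cb)))))
    ...   | inj₂ Cu≡Cw = ⊥-elim (Cb≢R (trans (sym Cw≡Cb) (trans (sym (returns p∣u+v w)) (trans (sym Cu≡Cw) Cu≡R))))

    translate* : ∀ n → C (b + n * v) ≡ C b
    translate* zero = cong C (+-identityʳ b)
    translate* (suc n) = trans (cong C b+[v+nv]≡b+nv+v) (translate (b + n * v) (translate* n))
      where
      b+[v+nv]≡b+nv+v : b + (v + n * v) ≡ b + n * v + v
      b+[v+nv]≡b+nv+v = trans (cong (b +_) (+-comm v (n * v))) (sym (+-assoc b (n * v) v))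

  -- Since v is a unit, some translate b + n v of b is 0 in Z_p; so the colour
  -- class of b cannot avoid both R and C v: only the colours R and C v occur.
  two-classes : ∀ {u v} → p ∣ u + v → C u ≡ R → C v ≢ R → ∀ b → C b ≢ R → C b ≡ C v
  two-classes {u} {v} p∣u+v Cu≡R Cv≢R b Cb≢R with C b ≟ C v
  ... | yes Cb≡Cv = Cb≡Cv
  ... | no Cb≢Cv with coprime⇒reaches-multiple (prime∤⇒coprime p-prime (Cv≢R ∘ multiple-R)) b
  ...   | n , p∣b+nv = ⊥-elim (Cb≢R (trans (sym (translate* p∣u+v Cu≡R Cv≢R Cb≢R Cb≢Cv n)) (multiple-R p∣b+nv)))

-- merge R sends R to zero and punchIn R a to a, thereby identifying the
-- colours R and punchIn R zero while keeping all others apart.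
merge : ∀ {j} → Fin (suc (suc j)) → Fin (suc (suc j)) → Fin (suc j)
merge R q with R ≟ q
... | yes _    = zero
... | no R≢q = punchOut R≢q

merge-self : ∀ {j} (R : Fin (suc (suc j))) → merge R R ≡ zero
merge-self R with R ≟ R
... | yes _  = refl
... | no R≢R = ⊥-elim (R≢R refl)

merge-punchIn : ∀ {j} (R : Fin (suc (suc j))) a → merge R (punchIn R a) ≡ a
merge-punchIn R a with R ≟ punchIn R a
... | yes R≡punchIn = ⊥-elim (punchInᵢ≢i R a (sym R≡punchIn))
... | no _          = trans (punchOut-cong R refl) (punchOut-punchIn R)

module MergedModPrime {p j} .{{_ : NonZero p}} (p-prime : Prime p)
  (c : Fin p → Fin (suc (suc j))) (onto : IsColoring p (suc (suc j)) c)
  (free : RainbowFree p (suc (suc j)) c) where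

  open ModPrime p-prime c free public

  S : Fin (suc (suc j))
  S = punchIn R zero

  φ : Fin (suc (suc j)) → Fin (suc j)
  φ = merge R

  -- If C u = R and C v ≠ R then C v = S: the colour S occurs (c is onto), and
  -- by `two-classes` it can only be C v.
  R-partner : ∀ {u v} → p ∣ u + v → C u ≡ R → φ (C u) ≡ φ (C v)
  R-partner {u} {v} p∣u+v Cu≡R with C v ≟ R
  ... | yes Cv≡R = cong φ (trans Cu≡R (sym Cv≡R))
  ... | no Cv≢R = begin
    φ (C u) ≡⟨ cong φ Cu≡R ⟩
    φ R     ≡⟨ merge-self R ⟩
    zero    ≡⟨ sym (merge-punchIn R zero) ⟩
    φ S     ≡⟨ cong φ S≡Cv ⟩
    φ (C v) ∎
    where
    open ≡-Reasoning
    y : Fin p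
    y = proj₁ (onto S)
    Cy≡S : C (toℕ y) ≡ S
    Cy≡S = trans (onℕ-toℕ c y) (proj₂ (onto S))
    S≡Cv : S ≡ C v
    S≡Cv = trans (sym Cy≡S)
      (two-classes p∣u+v Cu≡R Cv≢R (toℕ y) (punchInᵢ≢i R zero ∘ trans (sym Cy≡S)))

  -- In the triple (u, v, u + v) with u + v ≡ 0, one of u, v has colour R.
  inverses-merged : ∀ u v → p ∣ u + v → φ (C u) ≡ φ (C v)
  inverses-merged u v p∣u+v with C u ≟ C v
  ... | yes Cu≡Cv = cong φ Cu≡Cv
  ... | no Cu≢Cv with sum-colour u v Cu≢Cv
  ...   | inj₁ Cu≡Cu+v = R-partner p∣u+v (trans Cu≡Cu+v (multiple-R p∣u+v))
  ...   | inj₂ Cv≡Cu+v =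
    sym (R-partner (subst (p ∣_) (+-comm u v) p∣u+v) (trans Cv≡Cu+v (multiple-R p∣u+v)))

module BlowUp {p t r j} .{{_ : NonZero p}} .{{_ : NonZero t}} (p-prime : Prime p)
  (c₁ : Fin t → Fin r) (onto₁ : IsColoring t r c₁) (free₁ : RainbowFree t r c₁)
  (c₂ : Fin p → Fin (suc (suc j))) (onto₂ : IsColoring p (suc (suc j)) c₂)
  (free₂ : RainbowFree p (suc (suc j)) c₂) where

  open MergedModPrime p-prime c₂ onto₂ free₂

  colour : (n : ℕ) → Dec (p ∣ n) → Fin (r + suc j)
  colour n (yes p∣n) = onℕ c₁ (quotient p∣n) ↑ˡ suc j
  colour n (no _)    = r ↑ʳ φ (C n)

  blowUp : Fin (p * t) → Fin (r + suc j)
  blowUp x = colour (toℕ x) (p ∣? toℕ x)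

  colour-multiple : ∀ {n} q → n ≡ q * p → (d : Dec (p ∣ n)) → colour n d ≡ onℕ c₁ q ↑ˡ suc j
  colour-multiple q n≡qp (yes (divides q′ n≡q′p)) =
    cong (λ z → onℕ c₁ z ↑ˡ suc j) (*-cancelʳ-≡ q′ q p (trans (sym n≡q′p) n≡qp))
  colour-multiple q n≡qp (no p∤n) = ⊥-elim (p∤n (divides q n≡qp))

  colour-punchIn : ∀ {n} (y : Fin p) a → n ≡ toℕ y → c₂ y ≡ punchIn R a →
    (d : Dec (p ∣ n)) → colour n d ≡ r ↑ʳ a
  colour-punchIn y a refl cy≡punchIn (yes p∣y) = ⊥-elim (punchInᵢ≢i R a
    (trans (sym cy≡punchIn) (trans (sym (onℕ-toℕ c₂ y)) (multiple-R p∣y))))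
  colour-punchIn y a refl cy≡punchIn (no _) =
    cong (r ↑ʳ_) (trans (cong φ (trans (onℕ-toℕ c₂ y) cy≡punchIn)) (merge-punchIn R a))

  blowUp-onto : IsColoring (p * t) (r + suc j) blowUp
  blowUp-onto k with splitAt r k in split
  ... | inj₁ i = fromℕ< x₀p<pt , (begin
    blowUp (fromℕ< x₀p<pt) ≡⟨ colour-multiple (toℕ x₀) (toℕ-fromℕ< x₀p<pt) (p ∣? _) ⟩
    onℕ c₁ (toℕ x₀) ↑ˡ suc j ≡⟨ cong (_↑ˡ suc j) (trans (onℕ-toℕ c₁ x₀) (proj₂ (onto₁ i))) ⟩
    i ↑ˡ suc j ≡⟨ splitAt⁻¹-↑ˡ split ⟩
    k ∎)
    where
    open ≡-Reasoning
    x₀ : Fin t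
    x₀ = proj₁ (onto₁ i)
    x₀p<pt : toℕ x₀ * p < p * t
    x₀p<pt = subst (toℕ x₀ * p <_) (*-comm t p) (*-monoˡ-< p (toℕ<n x₀))
  ... | inj₂ a = fromℕ< y<pt ,
    trans (colour-punchIn y a (toℕ-fromℕ< y<pt) (proj₂ (onto₂ (punchIn R a))) (p ∣? _)) (splitAt⁻¹-↑ʳ split)
    where
    y : Fin p
    y = proj₁ (onto₂ (punchIn R a))
    y<pt : toℕ y < p * t
    y<pt = <-≤-trans (toℕ<n y) (m≤m*n p t)

  schur-mod-p : ∀ n₁ n₂ n₃ K → n₁ + n₂ ≡ n₃ + K * (p * t) → (n₁ + n₂) % p ≡ n₃ % p
  schur-mod-p n₁ n₂ n₃ K eq =
    trans (cong (_% p) eq) (%-remove-+ʳ n₃ (∣-trans (m∣m*n t) (n∣m*n K)))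

  quotient-schur : ∀ q₁ q₂ q₃ K → q₁ * p + q₂ * p ≡ q₃ * p + K * (p * t) →
    (q₁ + q₂) % t ≡ q₃ % t
  quotient-schur q₁ q₂ q₃ K eq =
    trans (cong (_% t) (*-cancelʳ-≡ (q₁ + q₂) (q₃ + K * t) p (begin
      (q₁ + q₂) * p           ≡⟨ *-distribʳ-+ p q₁ q₂ ⟩
      q₁ * p + q₂ * p         ≡⟨ eq ⟩
      q₃ * p + K * (p * t)    ≡⟨ regroup q₃ K p t ⟩
      (q₃ + K * t) * p        ∎)))
    ([m+kn]%n≡m%n q₃ K t)
    where
    open ≡-Reasoning
    regroup : ∀ q K p t → q * p + K * (p * t) ≡ (q + K * t) * p
    regroup = solve-∀

  colour-rainbowFree : ∀ {n₁ n₂ n₃} K → n₁ + n₂ ≡ n₃ + K * (p * t) →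
    (d₁ : Dec (p ∣ n₁)) (d₂ : Dec (p ∣ n₂)) (d₃ : Dec (p ∣ n₃)) →
    ¬ Distinct3 (colour n₁ d₁) (colour n₂ d₂) (colour n₃ d₃)
  colour-rainbowFree K eq (yes (divides-refl q₁)) (yes (divides-refl q₂)) (yes (divides-refl q₃)) =
    onℕ-rainbowFree free₁ (quotient-schur q₁ q₂ q₃ K eq) ∘ distinct-reflect (_↑ˡ suc j)
  colour-rainbowFree {n₁} {n₂} {n₃} K eq (no _) (no _) (no _) =
    onℕ-rainbowFree free₂ (schur-mod-p n₁ n₂ n₃ K eq) ∘ distinct-reflect (λ q → r ↑ʳ φ q)
  colour-rainbowFree {n₁} {n₂} {n₃} K eq (yes p∣n₁) (yes p∣n₂) (no p∤n₃) _ =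
    p∤n₃ (∣-summands p∣n₁ p∣n₂)
    where open SchurCongruence n₁ n₂ n₃ (schur-mod-p n₁ n₂ n₃ K eq)
  colour-rainbowFree {n₁} {n₂} {n₃} K eq (yes p∣n₁) (no p∤n₂) (yes p∣n₃) _ =
    p∤n₂ (∣-first-sum p∣n₁ p∣n₃)
    where open SchurCongruence n₁ n₂ n₃ (schur-mod-p n₁ n₂ n₃ K eq)
  colour-rainbowFree {n₁} {n₂} {n₃} K eq (no p∤n₁) (yes p∣n₂) (yes p∣n₃) _ =
    p∤n₁ (∣-second-sum p∣n₂ p∣n₃)
    where open SchurCongruence n₁ n₂ n₃ (schur-mod-p n₁ n₂ n₃ K eq)
  colour-rainbowFree {n₁} {n₂} {n₃} K eq (yes p∣n₁) (no _) (no _) (_ , _ , col₂≢col₃) =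
    col₂≢col₃ (cong (λ q → r ↑ʳ φ q) (onℕ-cong c₂ (∣-first⇒congruent p∣n₁)))
    where open SchurCongruence n₁ n₂ n₃ (schur-mod-p n₁ n₂ n₃ K eq)
  colour-rainbowFree {n₁} {n₂} {n₃} K eq (no _) (yes p∣n₂) (no _) (_ , col₁≢col₃ , _) =
    col₁≢col₃ (cong (λ q → r ↑ʳ φ q) (onℕ-cong c₂ (∣-second⇒congruent p∣n₂)))
    where open SchurCongruence n₁ n₂ n₃ (schur-mod-p n₁ n₂ n₃ K eq)
  colour-rainbowFree {n₁} {n₂} {n₃} K eq (no _) (no _) (yes p∣n₃) (col₁≢col₂ , _) =
    col₁≢col₂ (cong (r ↑ʳ_) (inverses-merged n₁ n₂ (∣-sum⇒∣-summands-sum p∣n₃)))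
    where open SchurCongruence n₁ n₂ n₃ (schur-mod-p n₁ n₂ n₃ K eq)

  blowUp-rainbowFree : RainbowFree (p * t) (r + suc j) blowUp
  blowUp-rainbowFree (x₁ , x₂ , x₃ , (K , eq) , rainbow) =
    colour-rainbowFree K eq (p ∣? toℕ x₁) (p ∣? toℕ x₂) (p ∣? toℕ x₃) rainbow

  rainbowFreeColoring : ExistsRainbowFreeColoring (p * t) (r + suc j)
  rainbowFreeColoring = blowUp , blowUp-onto , blowUp-rainbowFree

lemma7 : ∀ (p t r k : ℕ) → Prime p → 1 ≤ t → IsRb p k →
    ExistsRainbowFreeColoring t r →
    ExistsRainbowFreeColoring (p * t) (r + k ∸ 2)
lemma7 p t r k p-prime 1≤t rb@(_ , _ , minimal) (c₁ , onto₁ , free₁)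
  with rb≥3 (nonTrivial⇒n>1 p {{prime⇒nonTrivial p-prime}}) rb
... | s≤s (s≤s (s≤s {n = j} z≤n))
  with ¬forces⇒rainbowFree (minimal (suc (suc j)) (s≤s z≤n) (n<1+n (suc (suc j))))
...   | c₂ , onto₂ , free₂ =
  subst (ExistsRainbowFreeColoring (p * t)) (sym (+-∸-assoc r {suc (suc (suc j))} (s≤s (s≤s z≤n))))
    (BlowUp.rainbowFreeColoring {{prime⇒nonZero p-prime}} {{>-nonZero 1≤t}}
      p-prime c₁ onto₁ free₁ c₂ onto₂ free₂)
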